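{- Let $s\ge 2$ and let $G=K(n_1,\dots,n_s)$ be a complete $s$-partite graph with parts $V_1,\dots,V_s$. Let $j\in\{1,\dots,s\}$. If $n_j\ge 2$, then $\chi_1(G)=\chi_1(G-V_j)+1$.
   Context: $K(n_1,\dots,n_s)$ denotes the complete $s$-partite graph whose parts $V_1,\dots,V_s$ have $n_1,\dots,n_s$ vertices; $G-V_j$ is the graph obtained by deleting the vertices of $V_j$. A $1$-relaxed $k$-coloring is a map $f:V\to\{1,\dots,k\}$ such that every vertex $u$ has at most one neighbor $v$ with $f(v)=f(u)$; $\chi_1(G)$ is the minimum such $k$. -}

module Defs where

open import Level using (0ℓ)
open import Data.Nat using (ℕ; suc; _≤_)
open import Data.Fin using (Fin)
open import Data.Product using (Σ; ∃; _×_; _,_; proj₁)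
open import Relation.Binary.PropositionalEquality using (_≡_; _≢_)

record Graph : Set₁ where
  field
    Vertex : Set
    Adj    : Vertex → Vertex → Set
open Graph public

-- Complete s-partite graph K(n_1,…,n_s): vertex (i , x) lies in part V_i
-- (x ranges over the n i vertices of V_i); two vertices are adjacent iff
-- they lie in different parts.
CompleteMultipartite : (s : ℕ) → (Fin s → ℕ) → Graph
CompleteMultipartite s n = record
  { Vertex = Σ (Fin s) (λ i → Fin (n i))
  ; Adj    = λ u v → proj₁ u ≢ proj₁ v
  }

record Kept (G : Graph) (P : Vertex G → Set) : Set where
  constructor keep
  field
    vertex : Vertex G
    .kept  : P vertex
open Kept public

Induced : (G : Graph) → (Vertex G → Set) → Graph
Induced G P = record
  { Vertex = Kept G P
  ; Adj    = λ u v → Adj G (vertex u) (vertex v)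
  }

DeletePart : (s : ℕ) (n : Fin s → ℕ) (j : Fin s) → Graph
DeletePart s n j = Induced (CompleteMultipartite s n) (λ v → proj₁ v ≢ j)

-- 1-relaxed k-coloring: every vertex u has at most one neighbour v with
-- f v = f u.
IsRelaxedColoring : (G : Graph) (k : ℕ) → (Vertex G → Fin k) → Set
IsRelaxedColoring G k f =
  ∀ u v w → Adj G u v → Adj G u w → f v ≡ f u → f w ≡ f u → v ≡ w

RelaxedColorable : Graph → ℕ → Set
RelaxedColorable G k = Σ (Vertex G → Fin k) (IsRelaxedColoring G k)

IsChi1 : Graph → ℕ → Set
IsChi1 G k = RelaxedColorable G k × (∀ m → RelaxedColorable G m → k ≤ m)

-- Deleting the part V_j costs at least one colour: take two vertices x₁ ≠ x₂
-- of V_j, both adjacent to every vertex of G - V_j. In a 1-relaxed colouring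
-- f of G, the colour f(x₁) is used at most once on G - V_j (two such vertices
-- would be two neighbours of x₁ sharing its colour), and likewise f(x₂). Either way
-- one colour can be dropped. Conversely a colouring of G - V_j extends to G
-- by one fresh colour on the independent set V_j.
module Submission where

open import Defs
open import Data.Nat using (ℕ; suc; zero; _≤_; s≤s)
open import Data.Nat.Properties using (≤-antisym)
open import Data.Fin using (Fin; zero; suc; _≟_; punchOut; inject₁; fromℕ)
open import Data.Fin.Properties using (punchOut-injective; fromℕ≢inject₁; inject₁-injective)
open import Data.Product using (Σ; _×_; _,_; proj₁)
open import Data.Product.Properties using (,-injectiveʳ-UIP)
open import Data.Sum using (_⊎_; inj₁; inj₂)
open import Data.Empty using (⊥-elim; ⊥-elim-irr)
open import Function using (_∘_)
open import Relation.Nullary using (Dec; yes; no; ¬_; contradiction)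
open import Relation.Nullary.Decidable using (¬?)
open import Relation.Unary using (Decidable)
open import Relation.Binary.PropositionalEquality using (_≡_; _≢_; refl; sym; trans; cong)
open import Axiom.UniquenessOfIdentityProofs using (module Decidable⇒UIP)

Loopless : Graph → Set
Loopless G = ∀ v → ¬ Adj G v v

vertex-injective : ∀ {G P} {u v : Kept G P} → vertex u ≡ vertex v → u ≡ v
vertex-injective refl = refl

module _ (G : Graph) where

  relaxed-reflect : ∀ {k m} {f : Vertex G → Fin k} (g : Vertex G → Fin m) →
    (∀ u v → g v ≡ g u → f v ≡ f u) →
    IsRelaxedColoring G k f → IsRelaxedColoring G m g
  relaxed-reflect g g⇒f fcol u v w uv uw gv gw =
    fcol u v w uv uw (g⇒f u v gv) (g⇒f u w gw)

  relaxed-restrict : ∀ {k f} (P : Vertex G → Set) →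
    IsRelaxedColoring G k f → IsRelaxedColoring (Induced G P) k (f ∘ vertex)
  relaxed-restrict P fcol u v w uv uw fv fw =
    vertex-injective (fcol (vertex u) (vertex v) (vertex w) uv uw fv fw)

  dropUnusedColour : ∀ {k f} → IsRelaxedColoring G (suc k) f →
    (c : Fin (suc k)) → (∀ v → f v ≢ c) → RelaxedColorable G k
  dropUnusedColour {f = f} fcol c unused =
    g , relaxed-reflect g (λ u v → punchOut-injective (avoids v) (avoids u)) fcol
    where
    avoids : ∀ v → c ≢ f v
    avoids v = unused v ∘ sym
    g : Vertex G → Fin _
    g v = punchOut (avoids v)

  SubsingletonClass : ∀ {k} → (Vertex G → Fin k) → Fin k → Set
  SubsingletonClass f c = ∀ u v → f u ≡ c → f v ≡ c → u ≡ v

  -- On a loopless graph a colour class with at most two vertices never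
  -- violates 1-relaxedness, so two subsingleton classes may share a colour.
  mergeSubsingletonClasses : ∀ {k f} → Loopless G → IsRelaxedColoring G (suc k) f →
    {c d : Fin (suc k)} → c ≢ d → SubsingletonClass f c → SubsingletonClass f d →
    RelaxedColorable G k
  mergeSubsingletonClasses {f = f} loopless fcol {c} {d} c≢d single-c single-d =
    dropUnusedColour merged-relaxed d (λ v → merge-≢d (f v))
    where
    merge : Fin _ → Fin _
    merge x with x ≟ d
    ... | yes _ = c
    ... | no _ = x

    merge-≢d : ∀ x → merge x ≢ d
    merge-≢d x with x ≟ d
    ... | yes _ = c≢d
    ... | no x≢d = x≢d

    merge-≡c : ∀ x → merge x ≡ c → x ≡ c ⊎ x ≡ d
    merge-≡c x _  with x ≟ d
    merge-≡c x _  | yes x≡d = inj₂ x≡d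
    merge-≡c x eq | no _ = inj₁ eq

    merge-injective-off-c : ∀ x y → merge y ≢ c → merge x ≡ merge y → x ≡ y
    merge-injective-off-c x y y≢c eq with x ≟ d | y ≟ d
    ... | _     | yes _ = contradiction refl y≢c
    ... | yes _ | no _  = contradiction (sym eq) y≢c
    ... | no _  | no _  = eq

    pigeonhole : ∀ u v w → f u ≡ c ⊎ f u ≡ d → f v ≡ c ⊎ f v ≡ d → f w ≡ c ⊎ f w ≡ d →
      u ≢ v → u ≢ w → v ≡ w
    pigeonhole u v w _ (inj₁ v-c) (inj₁ w-c) _ _ = single-c v w v-c w-c
    pigeonhole u v w _ (inj₂ v-d) (inj₂ w-d) _ _ = single-d v w v-d w-d
    pigeonhole u v w (inj₁ u-c) (inj₁ v-c) (inj₂ _) u≢v _ = contradiction (single-c u v u-c v-c) u≢v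
    pigeonhole u v w (inj₂ u-d) (inj₁ _) (inj₂ w-d) _ u≢w = contradiction (single-d u w u-d w-d) u≢w
    pigeonhole u v w (inj₁ u-c) (inj₂ _) (inj₁ w-c) _ u≢w = contradiction (single-c u w u-c w-c) u≢w
    pigeonhole u v w (inj₂ u-d) (inj₂ v-d) (inj₁ _) u≢v _ = contradiction (single-d u v u-d v-d) u≢v

    adjacent⇒≢ : ∀ {u v} → Adj G u v → u ≢ v
    adjacent⇒≢ {u} uv refl = loopless u uv

    merged-relaxed : IsRelaxedColoring G (suc _) (merge ∘ f)
    merged-relaxed u v w uv uw gv gw with merge (f u) ≟ c
    ... | yes gu≡c =
      pigeonhole u v w (merge-≡c (f u) gu≡c) (merge-≡c (f v) (trans gv gu≡c))
        (merge-≡c (f w) (trans gw gu≡c)) (adjacent⇒≢ uv) (adjacent⇒≢ uw)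
    ... | no gu≢c =
      fcol u v w uv uw (merge-injective-off-c (f v) (f u) gu≢c gv)
        (merge-injective-off-c (f w) (f u) gu≢c gw)

  extendByFreshColour : ∀ {b} (P : Vertex G → Set) → Decidable P →
    (∀ u v → ¬ P u → ¬ P v → ¬ Adj G u v) →
    RelaxedColorable (Induced G P) b → RelaxedColorable G (suc b)
  extendByFreshColour {b} P P? independent (h , hcol) = f , fcol
    where
    colour : ∀ v → Dec (P v) → Fin (suc b)
    colour v (yes p) = inject₁ (h (keep v p))
    colour v (no _) = fromℕ b

    f : Vertex G → Fin (suc b)
    f v = colour v (P? v)

    sameColour : ∀ u v (du : Dec (P u)) (dv : Dec (P v)) → Adj G u v →
      colour v dv ≡ colour u du → Σ (P u) λ pu → Σ (P v) λ pv → h (keep v pv) ≡ h (keep u pu)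
    sameColour u v (yes pu) (yes pv) _  eq = pu , pv , inject₁-injective eq
    sameColour u v (yes _)  (no _)   _  eq = ⊥-elim (fromℕ≢inject₁ eq)
    sameColour u v (no _)   (yes _)  _  eq = ⊥-elim (fromℕ≢inject₁ (sym eq))
    sameColour u v (no ¬pu) (no ¬pv) uv _  = ⊥-elim (independent u v ¬pu ¬pv uv)

    fcol : IsRelaxedColoring G (suc b) f
    fcol u v w uv uw fv fw
      with sameColour u v (P? u) (P? v) uv fv | sameColour u w (P? u) (P? w) uw fw
    ... | pu , pv , hv | _ , pw , hw =
      cong vertex (hcol (keep u pu) (keep v pv) (keep w pw) uv uw hv hw)

twoDistinct : ∀ {m} → 2 ≤ m → Σ (Fin m) λ a → Σ (Fin m) λ b → a ≢ b
twoDistinct (s≤s (s≤s _)) = zero , suc zero , λ ()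

module _ (s : ℕ) (n : Fin s → ℕ) (j : Fin s) where

  private
    G = CompleteMultipartite s n
    H = DeletePart s n j

  deletePart-loopless : Loopless H
  deletePart-loopless _ uu = uu refl

  part-independent : ∀ u v → ¬ proj₁ u ≢ j → ¬ proj₁ v ≢ j → ¬ Adj G u v
  part-independent u v u∈j v∈j uv = u∈j (λ u≡j → v∈j (λ v≡j → uv (trans u≡j (sym v≡j))))

  twoVerticesInPart : 2 ≤ n j →
    Σ (Vertex G) λ x₁ → Σ (Vertex G) λ x₂ → proj₁ x₁ ≡ j × proj₁ x₂ ≡ j × x₁ ≢ x₂
  twoVerticesInPart nj≥2 with twoDistinct nj≥2
  ... | t₁ , t₂ , t₁≢t₂ =
    (j , t₁) , (j , t₂) , refl , refl ,
    t₁≢t₂ ∘ ,-injectiveʳ-UIP (Decidable⇒UIP.≡-irrelevant (_≟_ {s}))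

  part-adjacent : ∀ x → proj₁ x ≡ j → (u : Vertex H) → Adj G x (vertex u)
  part-adjacent _ x∈j (keep z z∉j) x≡z = ⊥-elim-irr (z∉j (trans (sym x≡z) x∈j))

  adjacent-part : ∀ x → proj₁ x ≡ j → (u : Vertex H) → Adj G (vertex u) x
  adjacent-part x x∈j u = part-adjacent x x∈j u ∘ sym

  upperBound : ∀ {b} → RelaxedColorable H b → RelaxedColorable G (suc b)
  upperBound = extendByFreshColour G _ (λ v → ¬? (proj₁ v ≟ j)) part-independent

  lowerBound : ∀ {k f} → IsRelaxedColoring G (suc k) f →
    ∀ {x₁ x₂} → proj₁ x₁ ≡ j → proj₁ x₂ ≡ j → x₁ ≢ x₂ → RelaxedColorable H k
  lowerBound {f = f} fcol {x₁} {x₂} x₁∈j x₂∈j x₁≢x₂ with f x₁ ≟ f x₂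
  ... | yes same =
    dropUnusedColour H (relaxed-restrict G _ fcol) (f x₁) λ u fu →
      x₁≢x₂ (fcol (vertex u) x₁ x₂ (adjacent-part x₁ x₁∈j u) (adjacent-part x₂ x₂∈j u)
                  (sym fu) (trans (sym same) (sym fu)))
  ... | no different =
    mergeSubsingletonClasses H deletePart-loopless (relaxed-restrict G _ fcol) different
      (subsingleton x₁∈j) (subsingleton x₂∈j)
    where
    subsingleton : ∀ {x} → proj₁ x ≡ j → SubsingletonClass H (f ∘ vertex) (f x)
    subsingleton {x} x∈j u v fu fv =
      vertex-injective (fcol x (vertex u) (vertex v)
        (part-adjacent x x∈j u) (part-adjacent x x∈j v) fu fv)

corollary4p2 : (s : ℕ) → 2 ≤ s → (n : Fin s → ℕ) → (∀ i → 1 ≤ n i) →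
    (j : Fin s) → 2 ≤ n j →
    (a b : ℕ) → IsChi1 (CompleteMultipartite s n) a →
    IsChi1 (DeletePart s n j) b → a ≡ suc b
corollary4p2 s _ n _ j nj≥2 a b (colA , minA) (colB , minB)
  with twoVerticesInPart s n j nj≥2
... | x₁ , x₂ , x₁∈j , x₂∈j , x₁≢x₂ with a | colA | minA
...   | zero  | f , _    | _    with () ← f x₁
...   | suc k | f , fcol | minA =
  ≤-antisym (minA (suc b) (upperBound s n j colB))
            (s≤s (minB k (lowerBound s n j fcol x₁∈j x₂∈j x₁≢x₂)))
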